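{- Suppose that $G$ contains a path $P = v_0 v_1 \ldots v_d$ of length $d$ consisting of uncolored non-leaf vertices, and suppose $\{1,3\} \subseteq \Phi(v_0)$. Then the game is in a winning position for Bob if either $d$ is odd and $\{1,3\} \subseteq \Phi(v_d)$, or $d$ is even and $\{2,4\} \subseteq \Phi(v_d)$.
   Context: Alice and Bob play the coloring game on a graph $G$ with color set $\{1,2,3,4\}$: they alternately color an uncolored vertex so that the partial coloring stays proper. At any moment, $\phi(v)$ denotes the color of a colored vertex $v$ and $\Phi(v)$ the set of colors appearing on neighbors of $v$. An uncolored vertex $v$ is surrounded if $\Phi(v)=\{1,2,3,4\}$; Bob wins if he surrounds a vertex. A leaf is a vertex of degree 1; a $v$-leaf is a leaf whose neighbor is $v$. Standing assumptions: every cycle of $G$ is odd; every non-leaf vertex of $G$ is adjacent to at least 8 leaves; Bob only colors leaves, and when he colors a $v$-leaf he uses a color not in $\Phi(v)$; Alice never colors a leaf; at every moment, every uncolored non-leaf vertex has at least one uncolored leaf. A winning position for Bob is a partial coloring, with Alice to move, from which Bob has a strategy guaranteeing that he surrounds some vertex. -}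

module Defs where

open import Data.Nat using (ℕ; zero; suc; _≤_; _*_; _≡ᵇ_)
open import Data.Fin using (Fin; zero; suc; inject₁; fromℕ; _≟_)
open import Data.Bool using (Bool; true; false; if_then_else_; _∧_)
open import Data.Maybe using (Maybe; just; nothing)
open import Data.List using (List; map; allFin)
open import Data.Nat.ListAction using (sum)
open import Data.Product using (Σ; ∃; ∃-syntax; _×_; _,_)
open import Data.Empty using (⊥)
open import Relation.Nullary using (¬_; yes; no)
open import Relation.Binary.PropositionalEquality using (_≡_; _≢_)
open import Function.Definitions using (Injective)

Even : ℕ → Set
Even k = ∃[ j ] k ≡ 2 * j

Odd : ℕ → Set
Odd k = ∃[ j ] k ≡ suc (2 * j)

record Graph : Set where
  field
    n      : ℕ
    adj    : Fin n → Fin n → Bool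
    sym    : ∀ u v → adj u v ≡ adj v u
    irrefl : ∀ v → adj v v ≡ false

-- Colours {1,2,3,4} are represented by Fin 4: colour k is the element k-1.
Colour : Set
Colour = Fin 4

col1 col2 col3 col4 : Colour
col1 = zero
col2 = suc zero
col3 = suc (suc zero)
col4 = suc (suc (suc zero))

module _ (G : Graph) where
  open Graph G

  Vertex : Set
  Vertex = Fin n

  Adj : Vertex → Vertex → Set
  Adj u v = adj u v ≡ true

  degree : Vertex → ℕ
  degree v = sum (map (λ u → if adj v u then 1 else 0) (allFin n))

  isLeafᵇ : Vertex → Bool
  isLeafᵇ v = degree v ≡ᵇ 1

  IsLeaf : Vertex → Set
  IsLeaf v = degree v ≡ 1

  leafCount : Vertex → ℕ
  leafCount v = sum (map (λ u → if adj v u ∧ isLeafᵇ u then 1 else 0) (allFin n))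

  -- every cycle of G is odd. A cycle of length m+1 ≥ 3 is an injective
  -- map f : Fin (suc m) → V with f i ~ f (i+1) and f m ~ f 0.
  AllCyclesOdd : Set
  AllCyclesOdd = ∀ (m : ℕ) (f : Fin (suc m) → Vertex) → 2 ≤ m → Injective _≡_ _≡_ f →
    (∀ (i : Fin m) → Adj (f (inject₁ i)) (f (suc i))) → Adj (f (fromℕ m)) (f zero) →
    Odd (suc m)

  LeafRich : Set
  LeafRich = ∀ v → ¬ IsLeaf v → 8 ≤ leafCount v

  Colouring : Set
  Colouring = Vertex → Maybe Colour

  _∈Φ[_]_ : Colour → Colouring → Vertex → Set
  c ∈Φ[ φ ] v = ∃[ u ] (Adj v u × φ u ≡ just c)

  Proper : Colouring → Set
  Proper φ = ∀ u v c → Adj u v → φ u ≡ just c → φ v ≢ just c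

  Surrounded : Colouring → Vertex → Set
  Surrounded φ v = φ v ≡ nothing × (∀ c → c ∈Φ[ φ ] v)

  SomeSurrounded : Colouring → Set
  SomeSurrounded φ = ∃[ v ] Surrounded φ v

  paint : Colouring → Vertex → Colour → Colouring
  paint φ v c u with u ≟ v
  ... | yes _ = just c
  ... | no  _ = φ u

  AliceMove : Colouring → Vertex → Colour → Set
  AliceMove φ v c = φ v ≡ nothing × ¬ IsLeaf v × ¬ (c ∈Φ[ φ ] v)

  BobMove : Colouring → Vertex → Colour → Set
  BobMove φ ℓ c = φ ℓ ≡ nothing × IsLeaf ℓ × ¬ (c ∈Φ[ φ ] ℓ) ×
                  (∀ w → Adj ℓ w → ¬ (c ∈Φ[ φ ] w))

  LeafInvariant : Colouring → Set
  LeafInvariant φ = ∀ v → φ v ≡ nothing → ¬ IsLeaf v →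
                    ∃[ ℓ ] (Adj v ℓ × IsLeaf ℓ × φ ℓ ≡ nothing)

  data Turn : Set where
    alice bob : Turn

  data Reachable (φ₀ : Colouring) : Turn → Colouring → Set where
    start : Reachable φ₀ alice φ₀
    stepA : ∀ {φ v c} → Reachable φ₀ alice φ → ¬ SomeSurrounded φ →
            AliceMove φ v c → Reachable φ₀ bob (paint φ v c)
    stepB : ∀ {φ ℓ c} → Reachable φ₀ bob φ → ¬ SomeSurrounded φ →
            BobMove φ ℓ c → Reachable φ₀ alice (paint φ ℓ c)

  InvariantAlways : Colouring → Set
  InvariantAlways φ₀ = ∀ t φ → Reachable φ₀ t φ → LeafInvariant φ

  -- Bob can force a surrounded vertex; BobWinsA: Alice to move, BobWinsB: Bob to move
  data BobWinsA (φ : Colouring) : Set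
  data BobWinsB (φ : Colouring) : Set

  data BobWinsA φ where
    doneA : SomeSurrounded φ → BobWinsA φ
    moveA : (∃[ v ] ∃[ c ] AliceMove φ v c) →
            (∀ v c → AliceMove φ v c → BobWinsB (paint φ v c)) → BobWinsA φ

  data BobWinsB φ where
    doneB : SomeSurrounded φ → BobWinsB φ
    moveB : ∀ ℓ c → BobMove φ ℓ c → BobWinsA (paint φ ℓ c) → BobWinsB φ

  WinningForBob : Colouring → Set
  WinningForBob = BobWinsA

  IsPath : (d : ℕ) → (Fin (suc d) → Vertex) → Set
  IsPath d P = Injective _≡_ _≡_ P × (∀ (i : Fin d) → Adj (P (inject₁ i)) (P (suc i)))

-- Split the colours into the classes {1,3} and {2,4}.  Call a path v₀ … v_d of uncoloured
-- non-leaves a threat if Φ(v₀) contains a whole class X and Φ(v_d) contains the whole class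
-- opposite to the one v_d gets in the alternating pattern X, ¬X, X, … (the hypotheses describe
-- a threat with X = {1,3}).  Bob wins from every threat, by induction on d.  For d = 0, v₀ sees
-- all four colours.  If Alice colours v_i with c, Bob plays the partner of c (the other colour
-- of its class) on a free leaf of v_{i-1} if the class of c is the pattern class at v_i, and of
-- v_{i+1} otherwise; this leaves the shorter threat v₀ … v_{i-1} or v_{i+1} … v_d.  If Alice
-- plays elsewhere, Bob adds a colour of class ¬X at v₀: Alice must answer at v₀, or Bob
-- completes ¬X there and surrounds v₀, and her answer has class ¬X, leaving the threat
-- v₁ … v_d.  Bob's moves are legal because a leaf's only neighbour is the vertex he plays next
-- to, and the standing invariant provides the free leaves.
module Submission where

open import Defs
open import Data.Bool using (Bool; true; false; not; if_then_else_)
open import Data.Bool.Properties using (not-involutive; ¬-not) renaming (_≟_ to _≟ᵇ_)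
open import Data.Fin using (Fin; zero; suc; fromℕ; fromℕ<; inject₁; toℕ; _≟_)
open import Data.Fin.Properties
  using (any?; all?; ¬∀⟶∃¬; toℕ-injective; toℕ<n; toℕ-fromℕ; toℕ-fromℕ<; toℕ-inject₁)
open import Data.List using (tabulate)
open import Data.List.Properties using (map-tabulate)
open import Data.Maybe using (just; nothing)
open import Data.Maybe.Properties using (≡-dec)
open import Data.Nat using (ℕ; zero; suc; _+_; _*_; _≤_; _<_; z≤n; s≤s; NonZero)
open import Data.Nat.DivMod using (_mod_; m%n<n; m<n⇒m%n≡m)
open import Data.Nat.Induction using (<-rec)
open import Data.Nat.ListAction using (sum)
open import Data.Nat.Properties
  using (≤-refl; ≤-trans; m≤m+n; m≤n+m; +-monoʳ-≤; +-comm; +-suc; +-identityʳ; +-cancelˡ-≡; *-suc;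
         m≤n⇒m<n∨m≡n; m≤n⇒∃[o]m+o≡n; m≤n⇒m≤1+n; <⇒≤; <⇒≢; m≢1+m+n; anyUpTo?)
open import Data.Product using (∃-syntax; _×_; _,_; proj₁; proj₂)
open import Data.Sum using (_⊎_; inj₁; inj₂; [_,_])
open import Function using (_∘_; id)
open import Induction.WellFounded using (WfRec)
open import Relation.Nullary using (¬_; yes; no; Dec; contradiction)
open import Relation.Nullary.Decidable using (_×-dec_)
open import Relation.Binary.PropositionalEquality
  using (_≡_; _≢_; refl; sym; trans; cong; subst; subst₂; module ≡-Reasoning)

colourClass : Colour → Bool
colourClass zero = false
colourClass (suc zero) = true
colourClass (suc (suc zero)) = false
colourClass (suc (suc (suc zero))) = true

partner : Colour → Colour
partner zero = suc (suc zero)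
partner (suc zero) = suc (suc (suc zero))
partner (suc (suc zero)) = zero
partner (suc (suc (suc zero))) = suc zero

sameClass⇒≡∨≡partner : ∀ c c′ → colourClass c′ ≡ colourClass c → c′ ≡ c ⊎ c′ ≡ partner c
sameClass⇒≡∨≡partner zero zero _ = inj₁ refl
sameClass⇒≡∨≡partner zero (suc (suc zero)) _ = inj₂ refl
sameClass⇒≡∨≡partner (suc zero) (suc zero) _ = inj₁ refl
sameClass⇒≡∨≡partner (suc zero) (suc (suc (suc zero))) _ = inj₂ refl
sameClass⇒≡∨≡partner (suc (suc zero)) zero _ = inj₂ refl
sameClass⇒≡∨≡partner (suc (suc zero)) (suc (suc zero)) _ = inj₁ refl
sameClass⇒≡∨≡partner (suc (suc (suc zero))) (suc zero) _ = inj₂ refl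
sameClass⇒≡∨≡partner (suc (suc (suc zero))) (suc (suc (suc zero))) _ = inj₁ refl
sameClass⇒≡∨≡partner zero (suc zero) ()
sameClass⇒≡∨≡partner zero (suc (suc (suc zero))) ()
sameClass⇒≡∨≡partner (suc zero) zero ()
sameClass⇒≡∨≡partner (suc zero) (suc (suc zero)) ()
sameClass⇒≡∨≡partner (suc (suc zero)) (suc zero) ()
sameClass⇒≡∨≡partner (suc (suc zero)) (suc (suc (suc zero))) ()
sameClass⇒≡∨≡partner (suc (suc (suc zero))) zero ()
sameClass⇒≡∨≡partner (suc (suc (suc zero))) (suc (suc zero)) ()

classRep : Bool → Colour
classRep false = zero
classRep true = suc zero

colourClass-classRep : ∀ K → colourClass (classRep K) ≡ K
colourClass-classRep false = refl
colourClass-classRep true = refl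

flips : ℕ → Bool → Bool
flips zero b = b
flips (suc n) b = flips n (not b)

flips-not : ∀ n b → flips n (not b) ≡ not (flips n b)
flips-not zero b = refl
flips-not (suc n) b = flips-not n (not b)

flips-+ : ∀ m n b → flips (m + n) b ≡ flips n (flips m b)
flips-+ zero n b = refl
flips-+ (suc m) n b = flips-+ m n (not b)

flips-split : ∀ i e b → flips (suc (suc (i + e))) b ≡ flips (suc e) (flips (suc i) b)
flips-split i e b = trans (cong (λ m → flips (suc m) b) (sym (+-suc i e))) (flips-+ (suc i) (suc e) b)

flips-dichotomy : ∀ n b b′ → b′ ≡ flips n b ⊎ b′ ≡ flips (suc n) b
flips-dichotomy n b b′ with b′ ≟ᵇ flips n b
... | yes b′≡ = inj₁ b′≡
... | no b′≢ = inj₂ (trans (¬-not b′≢) (sym (flips-not n b)))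

flips-even : ∀ j b → flips (2 * j) b ≡ b
flips-even zero b = refl
flips-even (suc j) b = begin
  flips (2 * suc j) b        ≡⟨ cong (λ m → flips m b) (*-suc 2 j) ⟩
  flips (2 * j) (not (not b)) ≡⟨ cong (flips (2 * j)) (not-involutive b) ⟩
  flips (2 * j) b            ≡⟨ flips-even j b ⟩
  b                          ∎
  where open ≡-Reasoning

term≤sum : ∀ {m} (g : Fin m → ℕ) i → g i ≤ sum (tabulate g)
term≤sum g zero = m≤m+n (g zero) _
term≤sum g (suc i) = ≤-trans (term≤sum (g ∘ suc) i) (m≤n+m _ (g zero))

two-terms≤sum : ∀ {m} (g : Fin m → ℕ) i j → i ≢ j → g i + g j ≤ sum (tabulate g)
two-terms≤sum g zero zero i≢j = contradiction refl i≢j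
two-terms≤sum g zero (suc j) _ = +-monoʳ-≤ (g zero) (term≤sum (g ∘ suc) j)
two-terms≤sum g (suc i) zero _ =
  subst (_≤ sum (tabulate g)) (+-comm (g zero) (g (suc i)))
    (+-monoʳ-≤ (g zero) (term≤sum (g ∘ suc) i))
two-terms≤sum g (suc i) (suc j) i≢j =
  ≤-trans (two-terms≤sum (g ∘ suc) i j (i≢j ∘ cong suc)) (m≤n+m _ (g zero))

toℕ-mod : ∀ {k n} .{{_ : NonZero n}} → k < n → toℕ (k mod n) ≡ k
toℕ-mod {k} {n} k<n = trans (toℕ-fromℕ< (m%n<n k n)) (m<n⇒m%n≡m k<n)

mod-toℕ : ∀ {n k} (i : Fin (suc n)) → toℕ i ≡ k → k mod suc n ≡ i
mod-toℕ i refl = toℕ-injective (toℕ-mod (toℕ<n i))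

module _ (G : Graph) where
  open Graph G using (adj)

  private
    V : Set
    V = Vertex G
    Col : Set
    Col = Colouring G

  adj-sym : ∀ {u v} → Adj G u v → Adj G v u
  adj-sym {u} {v} uv = trans (Graph.sym G v u) uv

  leaf-neighbour-unique : ∀ {ℓ v w} → IsLeaf G ℓ → Adj G ℓ v → Adj G ℓ w → w ≡ v
  leaf-neighbour-unique {ℓ} {v} {w} leaf ℓv ℓw with w ≟ v
  ... | yes w≡v = w≡v
  ... | no w≢v = contradiction (subst (2 ≤_) leaf two≤degree) λ { (s≤s ()) }
    where
    g : Vertex G → ℕ
    g u = if adj ℓ u then 1 else 0
    two≤degree : 2 ≤ degree G ℓ
    two≤degree with two-terms≤sum g v w (w≢v ∘ sym)
    ... | le rewrite ℓv | ℓw = subst (2 ≤_) (cong sum (sym (map-tabulate id g))) le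

  _∈Φ⟨_⟩_ : Colour → Col → V → Set
  c ∈Φ⟨ ψ ⟩ v = _∈Φ[_]_ G c ψ v

  _∈Φ⟨_⟩?_ : ∀ c ψ v → Dec (c ∈Φ⟨ ψ ⟩ v)
  c ∈Φ⟨ ψ ⟩? v = any? λ u → (adj v u ≟ᵇ true) ×-dec ≡-dec _≟_ (ψ u) (just c)

  surrounded? : ∀ ψ v → Dec (Surrounded G ψ v)
  surrounded? ψ v = ≡-dec _≟_ (ψ v) nothing ×-dec all? (λ c → c ∈Φ⟨ ψ ⟩? v)

  someSurrounded? : ∀ ψ → Dec (SomeSurrounded G ψ)
  someSurrounded? ψ = any? (surrounded? ψ)

  missing-colour : ∀ {ψ v} → ψ v ≡ nothing → ¬ Surrounded G ψ v → ∃[ c ] ¬ c ∈Φ⟨ ψ ⟩ v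
  missing-colour {ψ} {v} v-free ¬surr =
    ¬∀⟶∃¬ 4 _ (λ c → c ∈Φ⟨ ψ ⟩? v) (λ all∈ → ¬surr (v-free , all∈))

  paint-≡ : ∀ ψ v c → paint G ψ v c v ≡ just c
  paint-≡ ψ v c with v ≟ v
  ... | yes _ = refl
  ... | no v≢v = contradiction refl v≢v

  paint-≢ : ∀ ψ v c {u} → u ≢ v → paint G ψ v c u ≡ ψ u
  paint-≢ ψ v c {u} u≢v with u ≟ v
  ... | yes u≡v = contradiction u≡v u≢v
  ... | no _ = refl

  paint-∈Φ : ∀ ψ {x v} c → Adj G v x → c ∈Φ⟨ paint G ψ x c ⟩ v
  paint-∈Φ ψ {x} c vx = x , vx , paint-≡ ψ x c

  _⊑Φ_ : Col → Col → Set
  ψ ⊑Φ ψ′ = ∀ {c v} → c ∈Φ⟨ ψ ⟩ v → c ∈Φ⟨ ψ′ ⟩ v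

  ⊑Φ-trans : ∀ {ψ ψ′ ψ″} → ψ ⊑Φ ψ′ → ψ′ ⊑Φ ψ″ → ψ ⊑Φ ψ″
  ⊑Φ-trans ψ⊑ψ′ ψ′⊑ψ″ = ψ′⊑ψ″ ∘ ψ⊑ψ′

  paint-⊑Φ : ∀ {ψ x} c → ψ x ≡ nothing → ψ ⊑Φ paint G ψ x c
  paint-⊑Φ {ψ} {x} c x-free (u , vu , ψu) = u , vu , trans (paint-≢ ψ x c u≢x) ψu
    where
    u≢x : u ≢ x
    u≢x refl with trans (sym x-free) ψu
    ... | ()

  _⊆Φ⟨_⟩_ : Bool → Col → V → Set
  K ⊆Φ⟨ ψ ⟩ v = ∀ c → colourClass c ≡ K → c ∈Φ⟨ ψ ⟩ v

  ⊆Φ-mono : ∀ {ψ ψ′ K v} → ψ ⊑Φ ψ′ → K ⊆Φ⟨ ψ ⟩ v → K ⊆Φ⟨ ψ′ ⟩ v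
  ⊆Φ-mono ψ⊑ψ′ K⊆ c c∈K = ψ⊑ψ′ (K⊆ c c∈K)

  ∈Φ-partner⇒⊆Φ : ∀ {ψ c v} → c ∈Φ⟨ ψ ⟩ v → partner c ∈Φ⟨ ψ ⟩ v → colourClass c ⊆Φ⟨ ψ ⟩ v
  ∈Φ-partner⇒⊆Φ {c = c} c∈ p∈ c′ same with sameClass⇒≡∨≡partner c c′ same
  ... | inj₁ refl = c∈
  ... | inj₂ refl = p∈

  ⊆Φ-not⇒∈Φ : ∀ {ψ K v} → K ⊆Φ⟨ ψ ⟩ v → not K ⊆Φ⟨ ψ ⟩ v → ∀ c → c ∈Φ⟨ ψ ⟩ v
  ⊆Φ-not⇒∈Φ {K = K} K⊆ notK⊆ c with colourClass c ≟ᵇ K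
  ... | yes c∈K = K⊆ c c∈K
  ... | no c∉K = notK⊆ c (¬-not c∉K)

  ∉Φ⇒class-not : ∀ {ψ K v c} → K ⊆Φ⟨ ψ ⟩ v → ¬ c ∈Φ⟨ ψ ⟩ v → colourClass c ≡ not K
  ∉Φ⇒class-not {K = K} {c = c} K⊆ c∉ with colourClass c ≟ᵇ K
  ... | yes c∈K = contradiction (K⊆ c c∈K) c∉
  ... | no c∉K = ¬-not c∉K

  parity⇒⊆Φ : ∀ {ψ d v} →
    (Odd d × col1 ∈Φ⟨ ψ ⟩ v × col3 ∈Φ⟨ ψ ⟩ v) ⊎ (Even d × col2 ∈Φ⟨ ψ ⟩ v × col4 ∈Φ⟨ ψ ⟩ v) →
    flips (suc d) false ⊆Φ⟨ ψ ⟩ v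
  parity⇒⊆Φ {ψ} {v = v} (inj₁ ((j , refl) , 1∈ , 3∈)) =
    subst (_⊆Φ⟨ ψ ⟩ v) (sym (flips-even j false)) (∈Φ-partner⇒⊆Φ 1∈ 3∈)
  parity⇒⊆Φ {ψ} {v = v} (inj₂ ((j , refl) , 2∈ , 4∈)) =
    subst (_⊆Φ⟨ ψ ⟩ v) (sym (flips-even j true)) (∈Φ-partner⇒⊆Φ 2∈ 4∈)

  record LeafExtension (ψ ψ′ : Col) : Set where
    field
      Φ-grows : ψ ⊑Φ ψ′
      nonLeaf-fixed : ∀ {u} → ¬ IsLeaf G u → ψ′ u ≡ ψ u

  paint-leaf-extension : ∀ {ψ ℓ} c → IsLeaf G ℓ → ψ ℓ ≡ nothing → LeafExtension ψ (paint G ψ ℓ c)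
  paint-leaf-extension {ψ} {ℓ} c leaf ℓ-free = record
    { Φ-grows = paint-⊑Φ c ℓ-free
    ; nonLeaf-fixed = λ u-inner → paint-≢ ψ ℓ c λ { refl → u-inner leaf }
    }

  leaf-move : ∀ {ψ v ℓ c} → Adj G v ℓ → IsLeaf G ℓ → ψ ℓ ≡ nothing → ψ v ≡ nothing →
    ¬ c ∈Φ⟨ ψ ⟩ v → BobMove G ψ ℓ c
  leaf-move {ψ} {v} {ℓ} {c} vℓ leaf ℓ-free v-free c∉ = ℓ-free , leaf , c∉Φℓ , c∉Φ-neighbour
    where
    ℓv : Adj G ℓ v
    ℓv = adj-sym vℓ
    c∉Φℓ : ¬ c ∈Φ⟨ ψ ⟩ ℓ
    c∉Φℓ (u , ℓu , ψu) with leaf-neighbour-unique leaf ℓv ℓu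
    ... | refl with trans (sym v-free) ψu
    ... | ()
    c∉Φ-neighbour : ∀ w → Adj G ℓ w → ¬ c ∈Φ⟨ ψ ⟩ w
    c∉Φ-neighbour w ℓw rewrite leaf-neighbour-unique leaf ℓv ℓw = c∉

  colour-adding : ∀ {ψ v} c → ψ v ≡ nothing → ¬ Surrounded G ψ v →
    ∃[ c′ ] (¬ c′ ∈Φ⟨ ψ ⟩ v × (c′ ≡ c ⊎ c ∈Φ⟨ ψ ⟩ v))
  colour-adding {ψ} {v} c v-free ¬surr with c ∈Φ⟨ ψ ⟩? v
  ... | no c∉ = c , c∉ , inj₁ refl
  ... | yes c∈ with missing-colour v-free ¬surr
  ... | c′ , c′∉ = c′ , c′∉ , inj₂ c∈

  record Path (d : ℕ) (Q : ℕ → V) : Set where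
    field
      nonLeaf : ∀ {k} → k ≤ d → ¬ IsLeaf G (Q k)
      injective : ∀ {j k} → j ≤ d → k ≤ d → Q j ≡ Q k → j ≡ k
      adjacent : ∀ {k} → k < d → Adj G (Q k) (Q (suc k))

  Path-take : ∀ {i d Q} → i ≤ d → Path d Q → Path i Q
  Path-take i≤d path = record
    { nonLeaf = λ k≤i → nonLeaf (≤-trans k≤i i≤d)
    ; injective = λ j≤i k≤i → injective (≤-trans j≤i i≤d) (≤-trans k≤i i≤d)
    ; adjacent = λ k<i → adjacent (≤-trans k<i i≤d)
    }
    where open Path path

  Path-drop : ∀ s {e Q} → Path (s + e) Q → Path e (Q ∘ (s +_))
  Path-drop s {e} {Q} path = record
    { nonLeaf = λ k≤e → nonLeaf (+-monoʳ-≤ s k≤e)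
    ; injective = λ j≤e k≤e → +-cancelˡ-≡ s _ _ ∘ injective (+-monoʳ-≤ s j≤e) (+-monoʳ-≤ s k≤e)
    ; adjacent = λ {k} k<e → subst (λ m → Adj G (Q (s + k)) (Q m)) (sym (+-suc s k))
        (adjacent (subst (_≤ s + e) (+-suc s k) (+-monoʳ-≤ s k<e)))
    }
    where open Path path

  -- Indices beyond d wrap around; they never occur below.
  Path-fromFin : ∀ {d} {P : Fin (suc d) → V} → IsPath G d P → (∀ i → ¬ IsLeaf G (P i)) →
    Path d (λ k → P (k mod suc d))
  Path-fromFin {d} {P} (P-injective , P-adjacent) inner = record
    { nonLeaf = λ _ → inner _
    ; injective = λ j≤d k≤d eq →
        trans (sym (toℕ-mod (s≤s j≤d))) (trans (cong toℕ (P-injective eq)) (toℕ-mod (s≤s k≤d)))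
    ; adjacent = λ k<d → subst₂ (λ a b → Adj G (P a) (P b))
        (sym (mod-toℕ (inject₁ (fromℕ< k<d)) (trans (toℕ-inject₁ _) (toℕ-fromℕ< k<d))))
        (sym (mod-toℕ (suc (fromℕ< k<d)) (cong suc (toℕ-fromℕ< k<d))))
        (P-adjacent (fromℕ< k<d))
    }

  Uncoloured : Col → ℕ → (ℕ → V) → Set
  Uncoloured ψ d Q = ∀ {k} → k ≤ d → ψ (Q k) ≡ nothing

  uncoloured-paint : ∀ {ψ d Q x} c → (∀ {k} → k ≤ d → Q k ≢ x) →
    Uncoloured ψ d Q → Uncoloured (paint G ψ x c) d Q
  uncoloured-paint {ψ} {x = x} c off free k≤d = trans (paint-≢ ψ x c (off k≤d)) (free k≤d)

  uncoloured-extension : ∀ {ψ ψ′ d Q} → Path d Q → LeafExtension ψ ψ′ →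
    Uncoloured ψ d Q → Uncoloured ψ′ d Q
  uncoloured-extension path ext free k≤d =
    trans (LeafExtension.nonLeaf-fixed ext (Path.nonLeaf path k≤d)) (free k≤d)

  record Threat (ψ : Col) (d : ℕ) (Q : ℕ → V) (X : Bool) : Set where
    field
      uncoloured : Uncoloured ψ d Q
      atStart : X ⊆Φ⟨ ψ ⟩ Q 0
      atEnd : flips (suc d) X ⊆Φ⟨ ψ ⟩ Q d

  threat-mono : ∀ {ψ ψ′ d Q X} → ψ ⊑Φ ψ′ → Uncoloured ψ′ d Q → Threat ψ d Q X → Threat ψ′ d Q X
  threat-mono ψ⊑ψ′ free t = record
    { uncoloured = free
    ; atStart = ⊆Φ-mono ψ⊑ψ′ (Threat.atStart t)
    ; atEnd = ⊆Φ-mono ψ⊑ψ′ (Threat.atEnd t)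
    }

  threat-paint : ∀ {ψ d Q X x} c → ψ x ≡ nothing → (∀ {k} → k ≤ d → Q k ≢ x) →
    Threat ψ d Q X → Threat (paint G ψ x c) d Q X
  threat-paint c x-free off t =
    threat-mono (paint-⊑Φ c x-free) (uncoloured-paint c off (Threat.uncoloured t)) t

  threat-extension : ∀ {ψ ψ′ d Q X} → Path d Q → LeafExtension ψ ψ′ →
    Threat ψ d Q X → Threat ψ′ d Q X
  threat-extension path ext t =
    threat-mono (LeafExtension.Φ-grows ext) (uncoloured-extension path ext (Threat.uncoloured t)) t

  module _ (φ₀ : Col) (inv : InvariantAlways G φ₀) where

    bob-adds : ∀ {ψ v} c → Reachable G φ₀ bob ψ → ψ v ≡ nothing → ¬ IsLeaf G v →
      (∀ {ψ′} → Reachable G φ₀ alice ψ′ → LeafExtension ψ ψ′ → c ∈Φ⟨ ψ′ ⟩ v → BobWinsA G ψ′) →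
      BobWinsB G ψ
    bob-adds {ψ} {v} c R v-free v-inner win with someSurrounded? ψ
    ... | yes surr = doneB surr
    ... | no ¬surr with inv bob ψ R v v-free v-inner
    ... | ℓ , vℓ , leaf , ℓ-free with colour-adding c v-free (¬surr ∘ (v ,_))
    ... | c′ , c′∉ , c-added = moveB ℓ c′ move
      (win (stepB R ¬surr move) (paint-leaf-extension c′ leaf ℓ-free) c∈)
      where
      move : BobMove G ψ ℓ c′
      move = leaf-move vℓ leaf ℓ-free v-free c′∉
      c∈ : c ∈Φ⟨ paint G ψ ℓ c′ ⟩ v
      c∈ = [ (λ { refl → paint-∈Φ ψ c vℓ }) , paint-⊑Φ c′ ℓ-free ] c-added

    bob-completes-class : ∀ {ψ v c} → Reachable G φ₀ bob ψ → ψ v ≡ nothing → ¬ IsLeaf G v →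
      c ∈Φ⟨ ψ ⟩ v →
      (∀ {ψ′} → Reachable G φ₀ alice ψ′ → LeafExtension ψ ψ′ → colourClass c ⊆Φ⟨ ψ′ ⟩ v →
        BobWinsA G ψ′) →
      BobWinsB G ψ
    bob-completes-class {c = c} R v-free v-inner c∈ win =
      bob-adds (partner c) R v-free v-inner λ R′ ext p∈ →
        win R′ ext (∈Φ-partner⇒⊆Φ (LeafExtension.Φ-grows ext c∈) p∈)

    bob-surrounds : ∀ {ψ v X c} → Reachable G φ₀ bob ψ → ψ v ≡ nothing → ¬ IsLeaf G v →
      X ⊆Φ⟨ ψ ⟩ v → c ∈Φ⟨ ψ ⟩ v → colourClass c ≡ not X → BobWinsB G ψ
    bob-surrounds {v = v} R v-free v-inner X⊆ c∈ c-class =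
      bob-completes-class R v-free v-inner c∈ λ _ ext class⊆ →
        doneA (v , trans (LeafExtension.nonLeaf-fixed ext v-inner) v-free ,
          ⊆Φ-not⇒∈Φ (⊆Φ-mono (LeafExtension.Φ-grows ext) X⊆) (subst (_⊆Φ⟨ _ ⟩ v) c-class class⊆))

    alice-moves : ∀ {ψ v} → Reachable G φ₀ alice ψ → ψ v ≡ nothing → ¬ IsLeaf G v →
      (∀ {x c} → Reachable G φ₀ bob (paint G ψ x c) → AliceMove G ψ x c →
        BobWinsB G (paint G ψ x c)) →
      BobWinsA G ψ
    alice-moves {ψ} {v} R v-free v-inner win with someSurrounded? ψ
    ... | yes surr = doneA surr
    ... | no ¬surr with missing-colour v-free (¬surr ∘ (v ,_))
    ... | c , c∉ = moveA (v , c , v-free , v-inner , c∉) λ _ _ move → win (stepA R ¬surr move) move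

    ThreatWins : ℕ → Set
    ThreatWins d = ∀ {ψ Q X} → Reachable G φ₀ alice ψ → Path d Q → Threat ψ d Q X → BobWinsA G ψ

    respond-forward : ∀ {i e ψ Q X c} → WfRec _<_ ThreatWins (suc (i + e)) →
      Reachable G φ₀ bob (paint G ψ (Q i) c) → AliceMove G ψ (Q i) c →
      Path (suc (i + e)) Q → Threat ψ (suc (i + e)) Q X → colourClass c ≡ flips (suc i) X →
      BobWinsB G (paint G ψ (Q i) c)
    respond-forward {i} {e} {ψ} {Q} {X} {c} shorter R₁ (Qi-free , _) path t c-class =
      bob-completes-class R₁ (free₁ z≤n) (Path.nonLeaf path′ z≤n) (paint-∈Φ ψ c next-adj)
        λ R₂ ext class⊆ → shorter (s≤s (m≤n+m e i)) R₂ path′ record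
          { uncoloured = uncoloured-extension path′ ext free₁
          ; atStart = class⊆
          ; atEnd = subst (_⊆Φ⟨ _ ⟩ Q (suc (i + e)))
              (trans (flips-split i e X) (cong (flips (suc e)) (sym c-class)))
              (⊆Φ-mono (⊑Φ-trans (paint-⊑Φ c Qi-free) (LeafExtension.Φ-grows ext)) (Threat.atEnd t))
          }
      where
      open Path path
      path′ : Path e (Q ∘ (suc i +_))
      path′ = Path-drop (suc i) path
      free₁ : Uncoloured (paint G ψ (Q i) c) e (Q ∘ (suc i +_))
      free₁ = uncoloured-paint c
        (λ k≤e → m≢1+m+n i ∘ sym ∘ injective (s≤s (+-monoʳ-≤ i k≤e)) (m≤n⇒m≤1+n (m≤m+n i e)))
        (λ k≤e → Threat.uncoloured t (s≤s (+-monoʳ-≤ i k≤e)))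
      next-adj : Adj G (Q (suc i + 0)) (Q i)
      next-adj = subst (λ m → Adj G (Q m) (Q i)) (sym (+-identityʳ (suc i)))
        (adj-sym (adjacent (s≤s (m≤m+n i e))))

    respond-backward : ∀ {i d ψ Q X c} → WfRec _<_ ThreatWins d → i < d →
      Reachable G φ₀ bob (paint G ψ (Q (suc i)) c) → AliceMove G ψ (Q (suc i)) c →
      Path d Q → Threat ψ d Q X → colourClass c ≡ flips (suc i) X →
      BobWinsB G (paint G ψ (Q (suc i)) c)
    respond-backward {i} {d} {ψ} {Q} {X} {c} shorter i<d R₁ (Qi-free , _) path t c-class =
      bob-completes-class R₁ (free₁ ≤-refl) (nonLeaf i≤d) (paint-∈Φ ψ c (adjacent i<d))
        λ R₂ ext class⊆ → shorter i<d R₂ path′ record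
          { uncoloured = uncoloured-extension path′ ext free₁
          ; atStart = ⊆Φ-mono (⊑Φ-trans (paint-⊑Φ c Qi-free) (LeafExtension.Φ-grows ext))
              (Threat.atStart t)
          ; atEnd = subst (_⊆Φ⟨ _ ⟩ Q i) c-class class⊆
          }
      where
      open Path path
      i≤d : i ≤ d
      i≤d = <⇒≤ i<d
      path′ : Path i Q
      path′ = Path-take i≤d path
      free₁ : Uncoloured (paint G ψ (Q (suc i)) c) i Q
      free₁ = uncoloured-paint c
        (λ k≤i → <⇒≢ (s≤s k≤i) ∘ injective (≤-trans k≤i i≤d) i<d)
        (λ k≤i → Threat.uncoloured t (≤-trans k≤i i≤d))

    respond-off-path : ∀ {d ψ Q X x c} → WfRec _<_ ThreatWins (suc d) →
      Reachable G φ₀ bob (paint G ψ x c) → AliceMove G ψ x c →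
      Path (suc d) Q → Threat ψ (suc d) Q X → (∀ {k} → k ≤ suc d → Q k ≢ x) →
      BobWinsB G (paint G ψ x c)
    respond-off-path {d} {ψ} {Q} {X} {x} {c} shorter R₁ (x-free , _) path t off =
      bob-adds (classRep (not X)) R₁ (Threat.uncoloured t₁ z≤n) Q₀-inner λ R₂ ext rep∈ →
        alice-again R₂ (threat-extension path ext t₁) rep∈
      where
      Q₀-inner : ¬ IsLeaf G (Q 0)
      Q₀-inner = Path.nonLeaf path z≤n
      t₁ : Threat (paint G ψ x c) (suc d) Q X
      t₁ = threat-paint c x-free off t
      -- Q 0 now sees both colours of X and one of not X, so Alice has to colour Q 0 herself.
      alice-again : ∀ {ψ₂} → Reachable G φ₀ alice ψ₂ → Threat ψ₂ (suc d) Q X →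
        classRep (not X) ∈Φ⟨ ψ₂ ⟩ Q 0 → BobWinsA G ψ₂
      alice-again {ψ₂} R₂ t₂ rep∈ = alice-moves R₂ (Threat.uncoloured t₂ z≤n) Q₀-inner reply
        where
        reply : ∀ {y c′} → Reachable G φ₀ bob (paint G ψ₂ y c′) → AliceMove G ψ₂ y c′ →
          BobWinsB G (paint G ψ₂ y c′)
        reply {y} {c′} R₃ move@(y-free , _ , c′∉) with y ≟ Q 0
        ... | yes refl =
          respond-forward {i = 0} shorter R₃ move path t₂ (∉Φ⇒class-not (Threat.atStart t₂) c′∉)
        ... | no y≢Q₀ =
          bob-surrounds R₃ (trans (paint-≢ ψ₂ y c′ (y≢Q₀ ∘ sym)) (Threat.uncoloured t₂ z≤n))
            Q₀-inner (⊆Φ-mono (paint-⊑Φ c′ y-free) (Threat.atStart t₂))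
            (paint-⊑Φ c′ y-free rep∈) (colourClass-classRep (not X))

    respond-on-path : ∀ {d ψ Q X i c} → WfRec _<_ ThreatWins (suc d) → i ≤ suc d →
      Reachable G φ₀ bob (paint G ψ (Q i) c) → AliceMove G ψ (Q i) c →
      Path (suc d) Q → Threat ψ (suc d) Q X → BobWinsB G (paint G ψ (Q i) c)
    respond-on-path {X = X} {i} {c} shorter i≤ R₁ move@(_ , _ , c∉) path t
      with flips-dichotomy i X (colourClass c)
    respond-on-path {i = zero} {c} _ _ _ (_ , _ , c∉) _ t | inj₁ c-class =
      contradiction (Threat.atStart t c c-class) c∉
    respond-on-path {i = suc i} shorter i<d R₁ move path t | inj₁ c-class =
      respond-backward shorter i<d R₁ move path t c-class
    ... | inj₂ c-class with m≤n⇒m<n∨m≡n i≤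
    ...   | inj₂ refl = contradiction (Threat.atEnd t c c-class) c∉
    ...   | inj₁ (s≤s i≤d) with m≤n⇒∃[o]m+o≡n i≤d
    ...     | e , refl = respond-forward shorter R₁ move path t c-class

    threat-wins : ∀ d → ThreatWins d
    threat-wins = <-rec ThreatWins step
      where
      step : ∀ d → WfRec _<_ ThreatWins d → ThreatWins d
      step zero _ {Q = Q} _ _ t =
        doneA (Q 0 , Threat.uncoloured t z≤n , ⊆Φ-not⇒∈Φ (Threat.atStart t) (Threat.atEnd t))
      step (suc d) shorter {ψ} {Q} R path t =
        alice-moves R (Threat.uncoloured t z≤n) (Path.nonLeaf path z≤n) respond
        where
        respond : ∀ {x c} → Reachable G φ₀ bob (paint G ψ x c) → AliceMove G ψ x c →
          BobWinsB G (paint G ψ x c)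
        respond {x} R₁ move with anyUpTo? (λ k → Q k ≟ x) (suc (suc d))
        ... | yes (i , s≤s i≤ , refl) = respond-on-path shorter i≤ R₁ move path t
        ... | no off = respond-off-path shorter R₁ move path t λ k≤ Qk≡x → off (_ , s≤s k≤ , Qk≡x)

lemma1 : (G : Graph) → AllCyclesOdd G → LeafRich G →
    (φ : Colouring G) → Proper G φ → InvariantAlways G φ →
    (d : ℕ) (P : Fin (suc d) → Vertex G) → IsPath G d P →
    (∀ i → φ (P i) ≡ nothing × ¬ IsLeaf G (P i)) →
    _∈Φ[_]_ G col1 φ (P zero) → _∈Φ[_]_ G col3 φ (P zero) →
    ((Odd d × _∈Φ[_]_ G col1 φ (P (fromℕ d)) × _∈Φ[_]_ G col3 φ (P (fromℕ d)))
     ⊎ (Even d × _∈Φ[_]_ G col2 φ (P (fromℕ d)) × _∈Φ[_]_ G col4 φ (P (fromℕ d)))) →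
    WinningForBob G φ
lemma1 G _ _ φ _ inv d P isPath P-free-inner 1∈ 3∈ ends =
  threat-wins G φ inv d start (Path-fromFin G isPath (proj₂ ∘ P-free-inner)) record
    { uncoloured = λ _ → proj₁ (P-free-inner _)
    ; atStart = ∈Φ-partner⇒⊆Φ G 1∈ 3∈
    ; atEnd = subst (λ i → _⊆Φ⟨_⟩_ G (flips (suc d) false) φ (P i))
        (sym (mod-toℕ (fromℕ d) (toℕ-fromℕ d))) (parity⇒⊆Φ G ends)
    }
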